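{- If $\mathrm{P} = \mathrm{NP}$, then no $\mathrm{NP}$-complete set $S$ has the property that there is a set $D\in\mathrm{P}$ such that both $S\cap D$ and $S\cap\overline{D}$ are $\mathrm{NP}$-incomplete (i.e., are in $\mathrm{NP}$ yet are not $\mathrm{NP}$-complete).
   Context: All sets are over $\Sigma=\{0,1\}$; $\overline{D}=\Sigma^*\setminus D$. $\mathrm{NP}$-completeness is with respect to polynomial-time many-one reductions ($A \le^p_m B$ iff there is a polynomial-time computable $f$ with $x\in A\iff f(x)\in B$; $B$ is $\mathrm{NP}$-complete if $B\in\mathrm{NP}$ and every $\mathrm{NP}$ set $\le^p_m$-reduces to $B$). -}

module Defs where

open import Data.Nat using (ℕ; zero; suc; _+_; _*_; _^_; _≤_)
open import Data.Bool using (Bool; true; false)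
open import Data.Fin using (Fin)
open import Data.Maybe using (Maybe; just; nothing)
open import Data.List using (List; []; _∷_; _++_; length)
open import Data.Sum using (_⊎_; inj₁; inj₂)
open import Data.Product using (Σ; ∃; _×_; _,_)
open import Relation.Nullary using (¬_)
open import Relation.Binary.PropositionalEquality using (_≡_)
open import Function.Bundles using (_⇔_)
open import Level using (Level; 0ℓ) renaming (suc to lsuc)

Str : Set
Str = List Bool

Lang : Set₁
Lang = Str → Set

_∩_ : Lang → Lang → Lang
(A ∩ B) x = A x × B x

∁ : Lang → Lang
∁ A x = ¬ A x

-- Machine model: deterministic single-tape Turing machines with tape
-- alphabet {0,1,blank} (blank = nothing), two-way infinite tape.

data Dir : Set where
  L R S : Dir

Sym : Set
Sym = Maybe Bool

-- non-halting states are Fin (suc n), start state is zero;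
-- halting states are inj₂ true (accept) and inj₂ false (reject).
record TM : Set where
  field
    n : ℕ
    δ : Fin (suc n) → Sym → (Fin (suc n) ⊎ Bool) × Sym × Dir
open TM public

record Config (k : ℕ) : Set where
  constructor cfg
  field
    state : Fin (suc k) ⊎ Bool
    left  : List Sym   -- cells to the left of the head, nearest first
    head  : Sym
    right : List Sym   -- cells to the right of the head, nearest first
open Config public

moveTape : List Sym → Sym → List Sym → Dir → List Sym × Sym × List Sym
moveTape l h r S = l , h , r
moveTape [] h r L = [] , nothing , h ∷ r
moveTape (a ∷ l) h r L = l , a , h ∷ r
moveTape l h [] R = h ∷ l , nothing , []
moveTape l h (a ∷ r) R = h ∷ l , a , r

step : (M : TM) → Config (n M) → Config (n M)
step M (cfg (inj₂ b) l h r) = cfg (inj₂ b) l h r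
step M (cfg (inj₁ q) l h r) with δ M q h
... | q' , w , d with moveTape l w r d
...   | l' , h' , r' = cfg q' l' h' r'

exec : (M : TM) → ℕ → Config (n M) → Config (n M)
exec M zero c = c
exec M (suc t) c = exec M t (step M c)

initial : (M : TM) → Str → Config (n M)
initial M [] = cfg (inj₁ Fin.zero) [] nothing []
  where import Data.Fin as Fin
initial M (b ∷ x) = cfg (inj₁ Fin.zero) [] (just b) (Data.List.map just x)
  where import Data.Fin as Fin
        import Data.List

-- output of a halted machine: the maximal blank-free word starting at the head
readOut : List Sym → Str
readOut [] = []
readOut (nothing ∷ _) = []
readOut (just b ∷ s) = b ∷ readOut s

output : {k : ℕ} → Config k → Str
output c = readOut (head c ∷ right c)

poly : ℕ → ℕ → ℕ → ℕ
poly c k m = c * m ^ k + c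

DecidesIn : TM → ℕ → ℕ → Lang → Set
DecidesIn M c k A = ∀ x → Σ ℕ λ t → t ≤ poly c k (length x) ×
  ((state (exec M t (initial M x)) ≡ inj₂ true × A x)
   ⊎ (state (exec M t (initial M x)) ≡ inj₂ false × ¬ A x))

InP : Lang → Set
InP A = Σ TM λ M → Σ ℕ λ c → Σ ℕ λ k → DecidesIn M c k A

InFP : (Str → Str) → Set
InFP f = Σ TM λ M → Σ ℕ λ c → Σ ℕ λ k → ∀ x → Σ ℕ λ t → t ≤ poly c k (length x) ×
  Σ Bool λ b → state (exec M t (initial M x)) ≡ inj₂ b × output (exec M t (initial M x)) ≡ f x

double : Str → Str
double [] = []
double (b ∷ x) = b ∷ b ∷ double x

pair : Str → Str → Str
pair x w = double x ++ (false ∷ true ∷ w)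

InNP : Lang → Set₁
InNP A = Σ Lang λ V → InP V × Σ ℕ λ c → Σ ℕ λ k →
  ∀ x → A x ⇔ (Σ Str λ w → length w ≤ poly c k (length x) × V (pair x w))

_≤ₘ_ : Lang → Lang → Set
A ≤ₘ B = Σ (Str → Str) λ f → InFP f × (∀ x → A x ⇔ B (f x))

NPComplete : Lang → Set₁
NPComplete B = InNP B × (∀ A → InNP A → A ≤ₘ B)

NPIncomplete : Lang → Set₁
NPIncomplete B = InNP B × ¬ NPComplete B

P≡NP : Set₁
P≡NP = ∀ A → InP A ⇔ InNP A

module Submission where

-- Under P = NP, every NP set B with a member y and a
-- non-member z is NP-complete: any A ∈ NP is then decided by a polynomial
-- time machine M, and "run M on x, then write y if it accepted and z if it
-- rejected" is a polynomial-time many-one reduction of A to B.  Conversely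
-- every NP-complete set S has a member and a non-member (the images of any
-- string under reductions from Σ* and from ∅, both of which lie in NP).
-- Given D ∈ P, a member y of S lies in D or in ∁ D; in the first case y and
-- the non-member of S witness that S ∩ D is nontrivial, in the second that
-- S ∩ ∁ D is, so one of the two NP sets is NP-complete.

open import Defs
open import Data.Product using (Σ; _×_; _,_; proj₁; proj₂)
open import Relation.Nullary using (¬_)
open import Data.Nat using (ℕ; zero; suc; _+_; _*_; _^_; _≤_; z≤n; s≤s)
open import Data.Nat.Properties
open import Data.Bool using (Bool; true; false)
open import Data.Fin using (Fin; zero; suc; _↑ˡ_; _↑ʳ_; splitAt)
open import Data.Fin.Properties using (splitAt-↑ˡ; splitAt-↑ʳ)
open import Data.Maybe using (just; nothing)
open import Data.List using (List; []; _∷_; _++_; length; reverse; _ʳ++_; map)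
open import Data.List.Properties using (ʳ++-defn; reverse-involutive)
open import Data.Sum using (_⊎_; inj₁; inj₂; [_,_]′) renaming (map₁ to mapState)
open import Data.Unit using (⊤; tt)
open import Data.Empty using (⊥; ⊥-elim)
open import Function.Base using (_∘_)
open import Function.Bundles using (_⇔_; mk⇔; Equivalence)
open import Relation.Binary.PropositionalEquality

exec-+ : ∀ M t u c → exec M (t + u) c ≡ exec M u (exec M t c)
exec-+ M zero    u c = refl
exec-+ M (suc t) u c = exec-+ M t u (step M c)

Transition : ℕ → Set
Transition k = (Fin (suc k) ⊎ Bool) × Sym × Dir

applyTransition : ∀ {k} → Transition k → List Sym → Sym → List Sym → Config k
applyTransition (q′ , w , d) l h r with moveTape l w r d
... | l′ , h′ , r′ = cfg q′ l′ h′ r′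

step-δ : ∀ M q l h r {tr} → δ M q h ≡ tr →
  step M (cfg (inj₁ q) l h r) ≡ applyTransition tr l h r
step-δ M q l h r refl = refl

relabel : ∀ {m k} → (Fin m → Fin (suc k)) → (Fin m ⊎ Bool) × Sym × Dir → Transition k
relabel e (q , w , d) = mapState e q , w , d

-- A writer is a chain of states writing a fixed list of symbols leftwards.
writerδ : (w : Sym) (ws : List Sym) → Bool →
  Fin (suc (length ws)) → (Fin (suc (length ws)) ⊎ Bool) × Sym × Dir
writerδ w []         b zero    = inj₂ b , w , S
writerδ w (w′ ∷ ws)  b zero    = inj₁ (suc zero) , w , L
writerδ w (w′ ∷ ws)  b (suc i) with writerδ w′ ws b i
... | q , x , d = mapState suc q , x , d

relabel-suc : ∀ {m k} (e : Fin (suc m) → Fin (suc k)) tr →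
  relabel e (let (q , w , d) = tr in mapState suc q , w , d) ≡ relabel (λ i → e (suc i)) tr
relabel-suc e (inj₁ q , w , d) = refl
relabel-suc e (inj₂ b , w , d) = refl

writer-run : ∀ M (w : Sym) (ws : List Sym) (b : Bool)
  (e : Fin (suc (length ws)) → Fin (suc (n M))) →
  (∀ i s → δ M (e i) s ≡ relabel e (writerδ w ws b i)) →
  ∀ l h r →
  let c = exec M (suc (length ws)) (cfg (inj₁ (e zero)) l h r) in
  state c ≡ inj₂ b × output c ≡ readOut ((w ∷ ws) ʳ++ r)
writer-run M w [] b e copy l h r rewrite copy zero h = refl , refl
writer-run M w (w′ ∷ ws) b e copy l h r rewrite copy zero h = continue l
  where
  copy′ : ∀ i s → δ M (e (suc i)) s ≡ relabel (λ i → e (suc i)) (writerδ w′ ws b i)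
  copy′ i s = trans (copy (suc i) s) (relabel-suc e (writerδ w′ ws b i))

  continue : ∀ l → let c = exec M (suc (length ws)) (applyTransition (inj₁ (e (suc zero)) , w , L) l h r) in
    state c ≡ inj₂ b × output c ≡ readOut ((w′ ∷ ws) ʳ++ (w ∷ r))
  continue []      = writer-run M w′ ws b (λ i → e (suc i)) copy′ [] nothing (w ∷ r)
  continue (a ∷ l) = writer-run M w′ ws b (λ i → e (suc i)) copy′ l a (w ∷ r)

readOut-written : ∀ y r → readOut ((nothing ∷ reverse (map just y)) ʳ++ r) ≡ y
readOut-written y r = begin
  readOut (reverse (map just y) ʳ++ (nothing ∷ r))
    ≡⟨ cong readOut (ʳ++-defn (reverse (map just y))) ⟩
  readOut (reverse (reverse (map just y)) ++ (nothing ∷ r))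
    ≡⟨ cong (λ v → readOut (v ++ (nothing ∷ r))) (reverse-involutive (map just y)) ⟩
  readOut (map just y ++ nothing ∷ r)
    ≡⟨ readOut-word y r ⟩
  y ∎
  where
  open ≡-Reasoning
  readOut-word : ∀ y r → readOut (map just y ++ nothing ∷ r) ≡ y
  readOut-word []      r = refl
  readOut-word (b ∷ y) r = cong (b ∷_) (readOut-word y r)

poly-+ : ∀ c K k m → poly c k m + K ≤ poly (c + K) k m
poly-+ c K k m = begin
  c * m ^ k + c + K                ≡⟨ +-assoc (c * m ^ k) c K ⟩
  c * m ^ k + (c + K)              ≤⟨ +-monoˡ-≤ (c + K) (m≤m+n (c * m ^ k) (K * m ^ k)) ⟩
  c * m ^ k + K * m ^ k + (c + K)  ≡⟨ cong (_+ (c + K)) (sym (*-distribʳ-+ (m ^ k) c K)) ⟩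
  (c + K) * m ^ k + (c + K)        ∎
  where open ≤-Reasoning

-- A decider followed by writers: M′ runs M and then outputs out v, where
-- v is the verdict of M.
module ThenWrite (M : TM) (out : Bool → Str) where

  tape : Bool → List Sym
  tape v = reverse (map just (out v))

  len : Bool → ℕ
  len v = suc (length (tape v))

  N : ℕ
  N = n M + (len true + len false)

  -- states of M′: those of M, then the writer for out true, then for out false
  writerState : (v : Bool) → Fin (len v) → Fin (suc N)
  writerState true  i = suc (n M) ↑ʳ (i ↑ˡ len false)
  writerState false i = suc (n M) ↑ʳ (len true ↑ʳ i)

  -- halting with verdict v is redirected to the start of writer v
  redirect : Fin (suc (n M)) ⊎ Bool → Fin (suc N) ⊎ Bool
  redirect (inj₁ p) = inj₁ (p ↑ˡ (len true + len false))
  redirect (inj₂ v) = inj₁ (writerState v zero)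

  redirectTransition : Transition (n M) → Transition N
  redirectTransition (q , w , d) = redirect q , w , d

  writerTransition : (v : Bool) → Fin (len v) → Transition N
  writerTransition v i = relabel (writerState v) (writerδ nothing (tape v) true i)

  M′ : TM
  M′ = record { n = N ; δ = λ q s →
    [ (λ p → redirectTransition (δ M p s))
    , (λ j → [ writerTransition true , writerTransition false ]′ (splitAt (len true) j))
    ]′ (splitAt (suc (n M)) q) }

  δ-writer : ∀ v i s → δ M′ (writerState v i) s ≡ writerTransition v i
  δ-writer true i s
    rewrite splitAt-↑ʳ (suc (n M)) (len true + len false) (i ↑ˡ len false)
          | splitAt-↑ˡ (len true) i (len false) = refl
  δ-writer false i s
    rewrite splitAt-↑ʳ (suc (n M)) (len true + len false) (len true ↑ʳ i)
          | splitAt-↑ʳ (len true) (len false) i = refl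

  δ-old : ∀ p s → δ M′ (p ↑ˡ (len true + len false)) s ≡ redirectTransition (δ M p s)
  δ-old p s rewrite splitAt-↑ˡ (suc (n M)) p (len true + len false) = refl

  embed : Config (n M) → Config N
  embed c = cfg (redirect (state c)) (left c) (head c) (right c)

  step-embed : ∀ q l h r → step M′ (embed (cfg (inj₁ q) l h r)) ≡ embed (step M (cfg (inj₁ q) l h r))
  step-embed q l h r = begin
    step M′ (embed (cfg (inj₁ q) l h r))
      ≡⟨ step-δ M′ (q ↑ˡ (len true + len false)) l h r (δ-old q h) ⟩
    applyTransition (redirectTransition (δ M q h)) l h r
      ≡⟨ applyTransition-redirect (δ M q h) ⟩
    embed (applyTransition (δ M q h) l h r)
      ≡⟨ cong embed (sym (step-δ M q l h r refl)) ⟩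
    embed (step M (cfg (inj₁ q) l h r)) ∎
    where
    open ≡-Reasoning
    applyTransition-redirect : ∀ tr →
      applyTransition (redirectTransition tr) l h r ≡ embed (applyTransition tr l h r)
    applyTransition-redirect (q′ , w , d) with moveTape l w r d
    ... | l′ , h′ , r′ = refl

  -- Each step of M is matched by at most one step of M′ (halted steps of M
  -- are idle and need none).
  simulate : ∀ t c → Σ ℕ λ t′ → t′ ≤ t × exec M′ t′ (embed c) ≡ embed (exec M t c)
  simulate zero c = 0 , z≤n , refl
  simulate (suc t) (cfg (inj₂ v) l h r) with simulate t (cfg (inj₂ v) l h r)
  ... | t′ , t′≤t , sim = t′ , m≤n⇒m≤1+n t′≤t , sim
  simulate (suc t) (cfg (inj₁ q) l h r) with simulate t (step M (cfg (inj₁ q) l h r))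
  ... | t′ , t′≤t , sim = suc t′ , s≤s t′≤t , trans (cong (exec M′ t′) (step-embed q l h r)) sim

  embed-initial : ∀ x → initial M′ x ≡ embed (initial M x)
  embed-initial []      = refl
  embed-initial (_ ∷ _) = refl

  run : ∀ x t v → state (exec M t (initial M x)) ≡ inj₂ v →
    Σ ℕ λ T → T ≤ t + len v × Σ Bool λ b →
      state (exec M′ T (initial M′ x)) ≡ inj₂ b × output (exec M′ T (initial M′ x)) ≡ out v
  run x t v halted with simulate t (initial M x)
  ... | t′ , t′≤t , sim =
    t′ + len v , +-monoˡ-≤ (len v) t′≤t , true ,
    trans (cong state afterWriter) (proj₁ written) ,
    trans (cong output afterWriter) (trans (proj₂ written) (readOut-written (out v) (right c)))
    where
    c = exec M t (initial M x)
    atWriter : exec M′ t′ (initial M′ x) ≡ cfg (inj₁ (writerState v zero)) (left c) (head c) (right c)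
    atWriter = trans (cong (exec M′ t′) (embed-initial x))
                 (trans sim (cong (λ s → cfg (redirect s) (left c) (head c) (right c)) halted))
    afterWriter : exec M′ (t′ + len v) (initial M′ x)
                ≡ exec M′ (len v) (cfg (inj₁ (writerState v zero)) (left c) (head c) (right c))
    afterWriter = trans (exec-+ M′ t′ (len v) (initial M′ x)) (cong (exec M′ (len v)) atWriter)
    written = writer-run M′ nothing (tape v) true (writerState v) (δ-writer v) (left c) (head c) (right c)

  len≤ : ∀ v → len v ≤ len true + len false
  len≤ true  = m≤m+n (len true) (len false)
  len≤ false = m≤n+m (len false) (len true)

verdict : ∀ {P Q : Set} → P ⊎ Q → Bool
verdict (inj₁ _) = true
verdict (inj₂ _) = false

decidable-≤ₘ-nontrivial : ∀ (A B : Lang) (y z : Str) → B y → ¬ B z → InP A → A ≤ₘ B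
decidable-≤ₘ-nontrivial A B y z By ¬Bz (M , c , k , decides) = f , f∈FP , correct
  where
  out : Bool → Str
  out true  = y
  out false = z

  open ThenWrite M out

  f : Str → Str
  f x = out (verdict (proj₂ (proj₂ (decides x))))

  correct : ∀ x → A x ⇔ B (f x)
  correct x with proj₂ (proj₂ (decides x))
  ... | inj₁ (_ , Ax)  = mk⇔ (λ _ → By) (λ _ → Ax)
  ... | inj₂ (_ , ¬Ax) = mk⇔ (λ Ax → ⊥-elim (¬Ax Ax)) (λ Bz → ⊥-elim (¬Bz Bz))

  K : ℕ
  K = len true + len false

  absorb : ∀ x t v {P : ℕ → Set} → t ≤ poly c k (length x) →
    (Σ ℕ λ T → T ≤ t + len v × P T) → Σ ℕ λ T → T ≤ poly (c + K) k (length x) × P T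
  absorb x t v t≤ (T , T≤ , p) =
    T , ≤-trans T≤ (≤-trans (+-mono-≤ t≤ (len≤ v)) (poly-+ c K k (length x))) , p

  computes : ∀ x → Σ ℕ λ T → T ≤ poly (c + K) k (length x) × Σ Bool λ b →
    state (exec M′ T (initial M′ x)) ≡ inj₂ b × output (exec M′ T (initial M′ x)) ≡ f x
  computes x with decides x
  ... | t , t≤ , inj₁ (halted , _) = absorb x t true t≤ (run x t true halted)
  ... | t , t≤ , inj₂ (halted , _) = absorb x t false t≤ (run x t false halted)

  f∈FP : InFP f
  f∈FP = M′ , c + K , k , computes

Everything : Lang
Everything _ = ⊤

Nothing : Lang
Nothing _ = ⊥

constTM : Bool → TM
constTM b = record { n = 0 ; δ = λ _ _ → inj₂ b , nothing , S }

constTM-halts : ∀ b x → state (exec (constTM b) 1 (initial (constTM b) x)) ≡ inj₂ b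
constTM-halts b []      = refl
constTM-halts b (_ ∷ _) = refl

Everything∈P : InP Everything
Everything∈P = constTM true , 1 , 0 , λ x → 1 , s≤s z≤n , inj₁ (constTM-halts true x , tt)

Nothing∈P : InP Nothing
Nothing∈P = constTM false , 1 , 0 , λ x → 1 , s≤s z≤n , inj₂ (constTM-halts false x , λ ())

Everything∈NP : InNP Everything
Everything∈NP = Everything , Everything∈P , 0 , 0 , λ x → mk⇔ (λ _ → [] , z≤n , tt) (λ _ → tt)

Nothing∈NP : InNP Nothing
Nothing∈NP = Nothing , Nothing∈P , 0 , 0 , λ x → mk⇔ ⊥-elim (λ { (_ , _ , ()) })

P⇒decidable : ∀ D → InP D → ∀ x → D x ⊎ ¬ D x
P⇒decidable D (_ , _ , _ , decides) x with proj₂ (proj₂ (decides x))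
... | inj₁ (_ , Dx)  = inj₁ Dx
... | inj₂ (_ , ¬Dx) = inj₂ ¬Dx

-- An NP-complete set has a member and a non-member: the images of the empty
-- string under reductions from Σ* and from ∅.
complete⇒nontrivial : ∀ B → NPComplete B → Σ Str λ y → Σ Str λ z → B y × ¬ B z
complete⇒nontrivial B (_ , hard) with hard Everything Everything∈NP | hard Nothing Nothing∈NP
... | f₁ , _ , reduces₁ | f₀ , _ , reduces₀ =
  f₁ [] , f₀ [] , Equivalence.to (reduces₁ []) tt , Equivalence.from (reduces₀ [])

nontrivial⇒complete : P≡NP → ∀ B (y z : Str) → B y → ¬ B z → InNP B → NPComplete B
nontrivial⇒complete p≡np B y z By ¬Bz B∈NP =
  B∈NP , λ A A∈NP → decidable-≤ₘ-nontrivial A B y z By ¬Bz (Equivalence.from (p≡np A) A∈NP)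

-- A member y of S lies in D or outside it; either way the corresponding half
-- of S is a nontrivial NP set, hence NP-complete under P = NP.  (S is bound
-- as A below, since S also names the head movement "stay".)
theorem5 : P≡NP → (S : Lang) → NPComplete S →
    ¬ (Σ Lang λ D → InP D × NPIncomplete (S ∩ D) × NPIncomplete (S ∩ ∁ D))
theorem5 p≡np A A-complete (D , D∈P , (A∩D∈NP , A∩D-incomplete) , (A∖D∈NP , A∖D-incomplete))
  with complete⇒nontrivial A A-complete
... | y , z , Ay , ¬Az with P⇒decidable D D∈P y
...   | inj₁ Dy  =
  A∩D-incomplete (nontrivial⇒complete p≡np (A ∩ D) y z (Ay , Dy) (¬Az ∘ proj₁) A∩D∈NP)
...   | inj₂ ¬Dy =
  A∖D-incomplete (nontrivial⇒complete p≡np (A ∩ ∁ D) y z (Ay , ¬Dy) (¬Az ∘ proj₁) A∖D∈NP)
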